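{- Let $(d_{n,k})_{n,k\ge0}=\left(\frac1{1-t},\frac t{1-t}\right)$ be Pascal's triangle, so $d_{n,k}=\binom nk$. Fix integers $p\ge2$ and $r\ge0$, and let $(\tilde d_{n,k})_{n,k\ge0}$ with $\tilde d_{n,k}=d_{pn+r,(p-1)n+r+k}$, which is a Riordan array $(\tilde g,\tilde f)$ (i.e. $\tilde d_{n,k}=[t^n]\tilde g(t)\tilde f(t)^k$). Then $$\tilde g(t)=\sum_{n\ge0}\binom{pn+r}{n}t^n=\left.\frac{(1+w)^{r+1}}{1-(p-1)w}\right|_{w=w(t)},$$ where $w(t)$ is the formal power series with $w(0)=0$ satisfying $w=t(1+w)^p$, and $$\tilde f(t)=\sum_{n\ge1}\frac{1}{pn+1}\binom{pn+1}{n}t^n=F_p(t)-1=t\,F_p(t)^p,$$ where $F_p(t)=\sum_{k\ge0}\frac{1}{(p-1)k+1}\binom{pk}{k}t^k$ is the $p$th order Fuss–Catalan generating function. Moreover $F_p\big(t(1-t)^{p-1}\big)=\frac1{1-t}$.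
   Context: A Riordan array $(g,f)$ (with $g(0)=1$, $f(0)=0$, $f'(0)\ne0$) is the lower triangular matrix with $(n,k)$ entry $[t^n]g(t)f(t)^k$. The $p$th order Fuss–Catalan function $F_p$ satisfies $F_p(t)=1+tF_p(t)^p$. -}

module Defs where

open import Data.Nat as ℕ using (ℕ; zero; suc; _∸_)
open import Data.Nat.Combinatorics using (_C_)
open import Data.Integer using (+_)
open import Data.Rational using (ℚ; _+_; _*_; _-_; _/_; 0ℚ; 1ℚ)
open import Relation.Binary.PropositionalEquality using (_≡_)

Series : Set
Series = ℕ → ℚ

infix 4 _≈ₛ_
_≈ₛ_ : Series → Series → Set
a ≈ₛ b = ∀ n → a n ≡ b n

ℕ→ℚ : ℕ → ℚ
ℕ→ℚ n = + n / 1

sumTo : ℕ → (ℕ → ℚ) → ℚ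
sumTo zero f = f 0
sumTo (suc n) f = sumTo n f + f (suc n)

oneₛ : Series
oneₛ zero = 1ℚ
oneₛ (suc _) = 0ℚ

tₛ : Series
tₛ 1 = 1ℚ
tₛ _ = 0ℚ

infixl 6 _⊕_ _⊖_
infixl 7 _⊗_ _·_
infixr 8 _^ₛ_

_⊕_ : Series → Series → Series
(a ⊕ b) n = a n + b n

_⊖_ : Series → Series → Series
(a ⊖ b) n = a n - b n

_·_ : ℚ → Series → Series
(c · a) n = c * a n

_⊗_ : Series → Series → Series
(a ⊗ b) n = sumTo n (λ i → a i * b (n ∸ i))

_^ₛ_ : Series → ℕ → Series
a ^ₛ zero = oneₛ
a ^ₛ suc k = a ⊗ (a ^ₛ k)

-- composition f(g(t)), meaningful when g(0) = 0:
-- [t^n] f(g) = Σ_{k ≤ n} f_k [t^n] g^k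
_∘ₛ_ : Series → Series → Series
(f ∘ₛ g) n = sumTo n (λ k → f k * (g ^ₛ k) n)

geomₛ : Series
geomₛ _ = 1ℚ

-- multiplicative inverse of a series a with a(0) = 1:  1/a = 1/(1-(1-a))
recipₛ : Series → Series
recipₛ a = geomₛ ∘ₛ (oneₛ ⊖ a)

d̃ : ℕ → ℕ → ℕ → ℕ → ℚ
d̃ p r n k = ℕ→ℚ ((p ℕ.* n ℕ.+ r) C ((p ∸ 1) ℕ.* n ℕ.+ r ℕ.+ k))

g̃ : ℕ → ℕ → Series
g̃ p r n = ℕ→ℚ ((p ℕ.* n ℕ.+ r) C n)

f̃ : ℕ → Series
f̃ p zero = 0ℚ
f̃ p (suc m) = (+ ((1 ℕ.+ p ℕ.* n) C n)) / (1 ℕ.+ p ℕ.* n)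
  where n = suc m

Fₚ : ℕ → Series
Fₚ p k = (+ ((p ℕ.* k) C k)) / (1 ℕ.+ (p ∸ 1) ℕ.* k)

IsRiordanArray : (ℕ → ℕ → ℚ) → Series → Series → Set
IsRiordanArray d g f = ∀ n k → d n k ≡ (g ⊗ (f ^ₛ k)) n

-- Everything rests on one uniqueness principle: a family of series X a with
-- X (a+1) = X a + t·H·X (a+p) is determined by X 0.  Multiplying F_p = 1 + t F_p^p by F_p^a
-- shows that the powers F_p^a form such a family for H = 1, and so do the columns
-- g̃_r = Σ C(pn+r, n) t^n and the closed form [t^n] F_p^a = C(a+pn, n) - p C(a+pn-1, n-1).
-- Comparing families gives F_p^a g̃_r = g̃_(a+r) and the coefficients of F_p, whence
-- f̃ = F_p - 1 = t F_p^p and f̃^k = t^k F_p^(pk), which is the Riordan property.  Composing with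
-- h = t(1-t)^(p-1) keeps the recurrence with H = (1-t)^(p-1), which (1-t)^(-a) also satisfies,
-- so F_p(h) = 1/(1-t).  Finally w = f̃ is the unique solution of w = t(1+w)^p, and
-- g̃_r (1 - (p-1) f̃) = F_p^(r+1) is checked on coefficients.
module Submission where

open import Defs
open import Data.Nat as ℕ using (ℕ; zero; suc; z≤n; s≤s; _≤_; _<_; _∸_)
import Data.Nat.Properties as ℕ
open import Data.Nat.Combinatorics using (_C_; nCk+nC[k+1]≡[n+1]C[k+1]; k>n⇒nCk≡0; nCk≡nC[n∸k]; nC1≡n)
open import Data.Nat.Tactic.RingSolver using (solve-∀)
import Data.Nat.Coprimality as Coprime
import Data.Integer as ℤ
import Data.Integer.Properties as ℤ
open import Data.Rational using (ℚ; 0ℚ; 1ℚ; mkℚ; toℚᵘ; _+_; _*_; _-_; _/_; 1/_)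
import Data.Rational.Properties as ℚ
import Data.Rational.Unnormalised as ℚᵘ
import Data.Rational.Unnormalised.Properties as ℚᵘ
open import Data.Rational.Solver using (module +-*-Solver)
open +-*-Solver using (solve; _:+_; _:*_; _:-_; _:=_; con)
open import Data.Product using (_×_; _,_)
open import Data.Sum using (inj₁; inj₂)
open import Level using (0ℓ)
open import Relation.Nullary using (yes; no)
open import Relation.Binary.Bundles using (Setoid)
import Relation.Binary.Reasoning.Setoid as SetoidReasoning
open import Relation.Binary.PropositionalEquality

ℕ→ℚ≡mkℚ : ∀ n → ℕ→ℚ n ≡ mkℚ (ℤ.+ n) 0 (Coprime.sym (Coprime.1-coprimeTo n))
ℕ→ℚ≡mkℚ n = ℚ.↥p/↧p≡p (mkℚ (ℤ.+ n) 0 (Coprime.sym (Coprime.1-coprimeTo n)))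

ℕ→ℚ-suc : ∀ n → ℕ→ℚ (suc n) ≡ 1ℚ + ℕ→ℚ n
ℕ→ℚ-suc n = ℚ.toℚᵘ-injective (begin
  toℚᵘ (ℕ→ℚ (suc n))             ≈⟨ ℚ.toℚᵘ-cong (ℕ→ℚ≡mkℚ (suc n)) ⟩
  ℚᵘ.mkℚᵘ (ℤ.+ suc n) 0          ≈⟨ ℚᵘ.*≡* (cong (λ m → (ℤ.+ 1 ℤ.+ m) ℤ.* ℤ.+ 1) (sym (ℤ.*-identityʳ (ℤ.+ n)))) ⟩
  ℚᵘ.1ℚᵘ ℚᵘ.+ ℚᵘ.mkℚᵘ (ℤ.+ n) 0  ≈⟨ ℚᵘ.+-congʳ ℚᵘ.1ℚᵘ (ℚ.toℚᵘ-cong (ℕ→ℚ≡mkℚ n)) ⟨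
  toℚᵘ 1ℚ ℚᵘ.+ toℚᵘ (ℕ→ℚ n)      ≈⟨ ℚ.toℚᵘ-homo-+ 1ℚ (ℕ→ℚ n) ⟨
  toℚᵘ (1ℚ + ℕ→ℚ n)              ∎)
  where open ℚᵘ.≃-Reasoning

ℕ→ℚ-homo-+ : ∀ m n → ℕ→ℚ (m ℕ.+ n) ≡ ℕ→ℚ m + ℕ→ℚ n
ℕ→ℚ-homo-+ zero    n = sym (ℚ.+-identityˡ (ℕ→ℚ n))
ℕ→ℚ-homo-+ (suc m) n = begin
  ℕ→ℚ (suc (m ℕ.+ n))     ≡⟨ ℕ→ℚ-suc (m ℕ.+ n) ⟩
  1ℚ + ℕ→ℚ (m ℕ.+ n)      ≡⟨ cong (1ℚ +_) (ℕ→ℚ-homo-+ m n) ⟩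
  1ℚ + (ℕ→ℚ m + ℕ→ℚ n)    ≡⟨ ℚ.+-assoc 1ℚ (ℕ→ℚ m) (ℕ→ℚ n) ⟨
  (1ℚ + ℕ→ℚ m) + ℕ→ℚ n    ≡⟨ cong (_+ ℕ→ℚ n) (ℕ→ℚ-suc m) ⟨
  ℕ→ℚ (suc m) + ℕ→ℚ n     ∎
  where open ≡-Reasoning

ℕ→ℚ-homo-* : ∀ m n → ℕ→ℚ (m ℕ.* n) ≡ ℕ→ℚ m * ℕ→ℚ n
ℕ→ℚ-homo-* zero    n = sym (ℚ.*-zeroˡ (ℕ→ℚ n))
ℕ→ℚ-homo-* (suc m) n = begin
  ℕ→ℚ (n ℕ.+ m ℕ.* n)     ≡⟨ ℕ→ℚ-homo-+ n (m ℕ.* n) ⟩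
  ℕ→ℚ n + ℕ→ℚ (m ℕ.* n)   ≡⟨ cong (ℕ→ℚ n +_) (ℕ→ℚ-homo-* m n) ⟩
  ℕ→ℚ n + ℕ→ℚ m * ℕ→ℚ n   ≡⟨ solve 2 (λ x y → y :+ x :* y := (con 1ℚ :+ x) :* y) refl (ℕ→ℚ m) (ℕ→ℚ n) ⟩
  (1ℚ + ℕ→ℚ m) * ℕ→ℚ n    ≡⟨ cong (_* ℕ→ℚ n) (ℕ→ℚ-suc m) ⟨
  ℕ→ℚ (suc m) * ℕ→ℚ n     ∎
  where open ≡-Reasoning

ℕ→ℚ-suc-* : ∀ m n → ℕ→ℚ (suc (m ℕ.* n)) ≡ 1ℚ + ℕ→ℚ m * ℕ→ℚ n
ℕ→ℚ-suc-* m n = trans (ℕ→ℚ-suc (m ℕ.* n)) (cong (1ℚ +_) (ℕ→ℚ-homo-* m n))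

a/d*d≡a : ∀ a d → ((ℤ.+ a) / suc d) * ℕ→ℚ (suc d) ≡ ℕ→ℚ a
a/d*d≡a a d = ℚ.toℚᵘ-injective (begin
  toℚᵘ ((ℤ.+ a) / suc d * ℕ→ℚ (suc d))
    ≈⟨ ℚ.toℚᵘ-homo-* ((ℤ.+ a) / suc d) (ℕ→ℚ (suc d)) ⟩
  toℚᵘ ((ℤ.+ a) / suc d) ℚᵘ.* toℚᵘ (ℕ→ℚ (suc d))
    ≈⟨ ℚᵘ.*-cong (ℚ.toℚᵘ-fromℚᵘ (ℚᵘ.mkℚᵘ (ℤ.+ a) d)) (ℚ.toℚᵘ-cong (ℕ→ℚ≡mkℚ (suc d))) ⟩
  ℚᵘ.mkℚᵘ (ℤ.+ a) d ℚᵘ.* ℚᵘ.mkℚᵘ (ℤ.+ suc d) 0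
    ≈⟨ ℚᵘ.*≡* (ℤ.*-assoc (ℤ.+ a) (ℤ.+ suc d) (ℤ.+ 1)) ⟩
  ℚᵘ.mkℚᵘ (ℤ.+ a) 0
    ≈⟨ ℚ.toℚᵘ-cong (ℕ→ℚ≡mkℚ a) ⟨
  toℚᵘ (ℕ→ℚ a)
    ∎)
  where open ℚᵘ.≃-Reasoning

*-cancelʳ-ℕ→ℚ-suc : ∀ x y d → x * ℕ→ℚ (suc d) ≡ y * ℕ→ℚ (suc d) → x ≡ y
*-cancelʳ-ℕ→ℚ-suc x y d xd≡yd = begin
  x                ≡⟨ ℚ.*-identityʳ x ⟨
  x * 1ℚ           ≡⟨ cong (x *_) (ℚ.*-inverseʳ k) ⟨
  x * (k * 1/ k)   ≡⟨ ℚ.*-assoc x k (1/ k) ⟨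
  (x * k) * 1/ k   ≡⟨ cong (_* 1/ k) (subst (λ z → x * z ≡ y * z) (ℕ→ℚ≡mkℚ (suc d)) xd≡yd) ⟩
  (y * k) * 1/ k   ≡⟨ ℚ.*-assoc y k (1/ k) ⟩
  y * (k * 1/ k)   ≡⟨ cong (y *_) (ℚ.*-inverseʳ k) ⟩
  y * 1ℚ           ≡⟨ ℚ.*-identityʳ y ⟩
  y                ∎
  where
    open ≡-Reasoning
    k : ℚ
    k = mkℚ (ℤ.+ suc d) 0 (Coprime.sym (Coprime.1-coprimeTo (suc d)))

a≡x*d⇒a/d≡x : ∀ a d x → ℕ→ℚ a ≡ x * ℕ→ℚ (suc d) → (ℤ.+ a) / suc d ≡ x
a≡x*d⇒a/d≡x a d x a≡xd = *-cancelʳ-ℕ→ℚ-suc ((ℤ.+ a) / suc d) x d (trans (a/d*d≡a a d) a≡xd)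

sumTo-cong≤ : ∀ n {f g : ℕ → ℚ} → (∀ i → i ≤ n → f i ≡ g i) → sumTo n f ≡ sumTo n g
sumTo-cong≤ zero    f≡g = f≡g 0 z≤n
sumTo-cong≤ (suc n) f≡g = cong₂ _+_ (sumTo-cong≤ n (λ i i≤n → f≡g i (ℕ.m≤n⇒m≤1+n i≤n))) (f≡g (suc n) ℕ.≤-refl)

sumTo-cong : ∀ n {f g : ℕ → ℚ} → (∀ i → f i ≡ g i) → sumTo n f ≡ sumTo n g
sumTo-cong n f≡g = sumTo-cong≤ n (λ i _ → f≡g i)

sumTo-zero : ∀ n f → (∀ i → i ≤ n → f i ≡ 0ℚ) → sumTo n f ≡ 0ℚ
sumTo-zero zero    f f≡0 = f≡0 0 z≤n
sumTo-zero (suc n) f f≡0 = cong₂ _+_ (sumTo-zero n f (λ i i≤n → f≡0 i (ℕ.m≤n⇒m≤1+n i≤n))) (f≡0 (suc n) ℕ.≤-refl)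

sumTo-suc-head : ∀ n f → sumTo (suc n) f ≡ f 0 + sumTo n (λ i → f (suc i))
sumTo-suc-head zero    f = refl
sumTo-suc-head (suc n) f = trans (cong (_+ f (suc (suc n))) (sumTo-suc-head n f)) (ℚ.+-assoc (f 0) _ _)

sumTo-+ : ∀ n f g → sumTo n (λ i → f i + g i) ≡ sumTo n f + sumTo n g
sumTo-+ zero    f g = refl
sumTo-+ (suc n) f g = trans (cong (_+ (f (suc n) + g (suc n))) (sumTo-+ n f g))
  (solve 4 (λ a b c d → (a :+ b) :+ (c :+ d) := (a :+ c) :+ (b :+ d)) refl (sumTo n f) (sumTo n g) (f (suc n)) (g (suc n)))

sumTo-- : ∀ n f g → sumTo n (λ i → f i - g i) ≡ sumTo n f - sumTo n g
sumTo-- zero    f g = refl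
sumTo-- (suc n) f g = trans (cong (_+ (f (suc n) - g (suc n))) (sumTo-- n f g))
  (solve 4 (λ a b c d → (a :- b) :+ (c :- d) := (a :+ c) :- (b :+ d)) refl (sumTo n f) (sumTo n g) (f (suc n)) (g (suc n)))

sumTo-*ˡ : ∀ n c f → sumTo n (λ i → c * f i) ≡ c * sumTo n f
sumTo-*ˡ zero    c f = refl
sumTo-*ˡ (suc n) c f = trans (cong (_+ c * f (suc n)) (sumTo-*ˡ n c f)) (sym (ℚ.*-distribˡ-+ c (sumTo n f) (f (suc n))))

sumTo-reverse : ∀ n f → sumTo n f ≡ sumTo n (λ i → f (n ∸ i))
sumTo-reverse zero    f = refl
sumTo-reverse (suc n) f = begin
  sumTo (suc n) f                             ≡⟨ sumTo-suc-head n f ⟩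
  f 0 + sumTo n (λ i → f (suc i))             ≡⟨ cong (f 0 +_) (sumTo-reverse n (λ i → f (suc i))) ⟩
  f 0 + sumTo n (λ i → f (suc (n ∸ i)))       ≡⟨ ℚ.+-comm (f 0) _ ⟩
  sumTo n (λ i → f (suc (n ∸ i))) + f 0       ≡⟨ cong₂ _+_ (sumTo-cong≤ n (λ i i≤n → cong f (sym (ℕ.+-∸-assoc 1 i≤n))))
                                                           (cong f (sym (ℕ.n∸n≡0 n))) ⟩
  sumTo n (λ i → f (suc n ∸ i)) + f (n ∸ n)   ∎
  where open ≡-Reasoning

sumTo-swap : ∀ n m (a : ℕ → ℕ → ℚ) → sumTo n (λ i → sumTo m (a i)) ≡ sumTo m (λ j → sumTo n (λ i → a i j))
sumTo-swap zero    m a = refl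
sumTo-swap (suc n) m a = trans (cong (_+ sumTo m (a (suc n))) (sumTo-swap n m a))
                               (sym (sumTo-+ m (λ j → sumTo n (λ i → a i j)) (a (suc n))))

sumTo-extend : ∀ {n} N f → n ≤ N → (∀ i → n < i → f i ≡ 0ℚ) → sumTo N f ≡ sumTo n f
sumTo-extend {n} N f n≤N f≡0 with ℕ.m≤n⇒m<n∨m≡n n≤N
sumTo-extend {n} N       f n≤N f≡0 | inj₂ refl        = refl
sumTo-extend {n} (suc N) f n≤N f≡0 | inj₁ (s≤s n≤N′) =
  trans (cong₂ _+_ (sumTo-extend N f n≤N′ f≡0) (f≡0 (suc N) (s≤s n≤N′))) (ℚ.+-identityʳ (sumTo n f))

-- Formal power series

≈ₛ-refl : ∀ {a} → a ≈ₛ a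
≈ₛ-refl n = refl

≈ₛ-sym : ∀ {a b} → a ≈ₛ b → b ≈ₛ a
≈ₛ-sym a≈b n = sym (a≈b n)

≈ₛ-trans : ∀ {a b c} → a ≈ₛ b → b ≈ₛ c → a ≈ₛ c
≈ₛ-trans a≈b b≈c n = trans (a≈b n) (b≈c n)

Series-setoid : Setoid 0ℓ 0ℓ
Series-setoid = record
  { Carrier       = Series
  ; _≈_           = _≈ₛ_
  ; isEquivalence = record { refl = ≈ₛ-refl ; sym = ≈ₛ-sym ; trans = ≈ₛ-trans }
  }

module ≈ₛ-Reasoning = SetoidReasoning Series-setoid

shift : Series → Series
shift a zero    = 0ℚ
shift a (suc n) = a n

tail : Series → Series
tail a n = a (suc n)

shift-cong : ∀ {a b} → a ≈ₛ b → shift a ≈ₛ shift b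
shift-cong a≈b zero    = refl
shift-cong a≈b (suc n) = a≈b n

⊕-cong : ∀ {a a′ b b′} → a ≈ₛ a′ → b ≈ₛ b′ → a ⊕ b ≈ₛ a′ ⊕ b′
⊕-cong a≈a′ b≈b′ n = cong₂ _+_ (a≈a′ n) (b≈b′ n)

⊕-congˡ : ∀ a {b b′} → b ≈ₛ b′ → a ⊕ b ≈ₛ a ⊕ b′
⊕-congˡ a = ⊕-cong (≈ₛ-refl {a})

⊗-suc : ∀ a b n → (a ⊗ b) (suc n) ≡ a 0 * b (suc n) + (tail a ⊗ b) n
⊗-suc a b n = sumTo-suc-head n (λ i → a i * b (suc n ∸ i))

⊗-cong≤ : ∀ n {a a′ b b′} → (∀ i → i ≤ n → a i ≡ a′ i) → (∀ i → i ≤ n → b i ≡ b′ i) →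
          (a ⊗ b) n ≡ (a′ ⊗ b′) n
⊗-cong≤ n a≡a′ b≡b′ = sumTo-cong≤ n (λ i i≤n → cong₂ _*_ (a≡a′ i i≤n) (b≡b′ (n ∸ i) (ℕ.m∸n≤m n i)))

⊗-cong : ∀ {a a′ b b′} → a ≈ₛ a′ → b ≈ₛ b′ → a ⊗ b ≈ₛ a′ ⊗ b′
⊗-cong a≈a′ b≈b′ n = ⊗-cong≤ n (λ i _ → a≈a′ i) (λ i _ → b≈b′ i)

⊗-congˡ : ∀ {a a′} b → a ≈ₛ a′ → a ⊗ b ≈ₛ a′ ⊗ b
⊗-congˡ b a≈a′ = ⊗-cong a≈a′ (≈ₛ-refl {b})

⊗-congʳ : ∀ a {b b′} → b ≈ₛ b′ → a ⊗ b ≈ₛ a ⊗ b′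
⊗-congʳ a = ⊗-cong (≈ₛ-refl {a})

⊗-comm : ∀ a b → a ⊗ b ≈ₛ b ⊗ a
⊗-comm a b n = trans (sumTo-reverse n (λ i → a i * b (n ∸ i)))
  (sumTo-cong≤ n (λ i i≤n → trans (cong (λ j → a (n ∸ i) * b j) (ℕ.m∸[m∸n]≡n i≤n)) (ℚ.*-comm (a (n ∸ i)) (b i))))

⊗-distribʳ-⊕ : ∀ a b c → (a ⊕ b) ⊗ c ≈ₛ a ⊗ c ⊕ b ⊗ c
⊗-distribʳ-⊕ a b c n = trans (sumTo-cong n (λ i → ℚ.*-distribʳ-+ (c (n ∸ i)) (a i) (b i))) (sumTo-+ n _ _)

⊗-distribʳ-⊖ : ∀ a b c → (a ⊖ b) ⊗ c ≈ₛ a ⊗ c ⊖ b ⊗ c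
⊗-distribʳ-⊖ a b c n = trans
  (sumTo-cong n (λ i → solve 3 (λ x y z → (x :- y) :* z := x :* z :- y :* z) refl (a i) (b i) (c (n ∸ i))))
  (sumTo-- n _ _)

⊗-distribˡ-⊖ : ∀ a b c → a ⊗ (b ⊖ c) ≈ₛ a ⊗ b ⊖ a ⊗ c
⊗-distribˡ-⊖ a b c n = trans (⊗-comm a (b ⊖ c) n)
  (trans (⊗-distribʳ-⊖ b c a n) (cong₂ _-_ (⊗-comm b a n) (⊗-comm c a n)))

·-⊗ : ∀ k a b → (k · a) ⊗ b ≈ₛ k · (a ⊗ b)
·-⊗ k a b n = trans (sumTo-cong n (λ i → ℚ.*-assoc k (a i) (b (n ∸ i)))) (sumTo-*ˡ n k _)

⊗-· : ∀ k a b → a ⊗ (k · b) ≈ₛ k · (a ⊗ b)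
⊗-· k a b n = trans (⊗-comm a (k · b) n) (trans (·-⊗ k b a n) (cong (k *_) (⊗-comm b a n)))

⊗-identityˡ : ∀ a → oneₛ ⊗ a ≈ₛ a
⊗-identityˡ a zero    = ℚ.*-identityˡ (a 0)
⊗-identityˡ a (suc n) = trans (⊗-suc oneₛ a n)
  (trans (cong₂ _+_ (ℚ.*-identityˡ (a (suc n))) (sumTo-zero n _ (λ i _ → ℚ.*-zeroˡ (a (n ∸ i))))) (ℚ.+-identityʳ _))

⊗-identityʳ : ∀ a → a ⊗ oneₛ ≈ₛ a
⊗-identityʳ a = ≈ₛ-trans (⊗-comm a oneₛ) (⊗-identityˡ a)

shift-⊗ : ∀ a b → shift a ⊗ b ≈ₛ shift (a ⊗ b)
shift-⊗ a b zero    = ℚ.*-zeroˡ (b 0)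
shift-⊗ a b (suc n) = trans (⊗-suc (shift a) b n)
  (trans (cong (_+ (a ⊗ b) n) (ℚ.*-zeroˡ (b (suc n)))) (ℚ.+-identityˡ _))

⊗-shift : ∀ a b → a ⊗ shift b ≈ₛ shift (a ⊗ b)
⊗-shift a b = ≈ₛ-trans (⊗-comm a (shift b)) (≈ₛ-trans (shift-⊗ b a) (shift-cong (⊗-comm b a)))

tₛ≈shift-oneₛ : tₛ ≈ₛ shift oneₛ
tₛ≈shift-oneₛ zero          = refl
tₛ≈shift-oneₛ (suc zero)    = refl
tₛ≈shift-oneₛ (suc (suc n)) = refl

tₛ-⊗ : ∀ a → tₛ ⊗ a ≈ₛ shift a
tₛ-⊗ a = ≈ₛ-trans (⊗-congˡ a tₛ≈shift-oneₛ) (≈ₛ-trans (shift-⊗ oneₛ a) (shift-cong (⊗-identityˡ a)))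

⊗-assoc : ∀ a b c → (a ⊗ b) ⊗ c ≈ₛ a ⊗ (b ⊗ c)
⊗-assoc a b c zero    = ℚ.*-assoc (a 0) (b 0) (c 0)
⊗-assoc a b c (suc n) = begin
  ((a ⊗ b) ⊗ c) (suc n)
    ≡⟨ ⊗-suc (a ⊗ b) c n ⟩
  (a 0 * b 0) * c (suc n) + (tail (a ⊗ b) ⊗ c) n
    ≡⟨ cong (a 0 * b 0 * c (suc n) +_) tail-ab⊗c ⟩
  (a 0 * b 0) * c (suc n) + (a 0 * (tail b ⊗ c) n + (tail a ⊗ (b ⊗ c)) n)
    ≡⟨ solve 5 (λ x y z u v → (x :* y) :* z :+ (x :* u :+ v) := x :* (y :* z :+ u) :+ v) refl
               (a 0) (b 0) (c (suc n)) ((tail b ⊗ c) n) ((tail a ⊗ (b ⊗ c)) n) ⟩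
  a 0 * (b 0 * c (suc n) + (tail b ⊗ c) n) + (tail a ⊗ (b ⊗ c)) n
    ≡⟨ cong (λ z → a 0 * z + (tail a ⊗ (b ⊗ c)) n) (⊗-suc b c n) ⟨
  a 0 * (b ⊗ c) (suc n) + (tail a ⊗ (b ⊗ c)) n
    ≡⟨ ⊗-suc a (b ⊗ c) n ⟨
  (a ⊗ (b ⊗ c)) (suc n)
    ∎
  where
    open ≡-Reasoning
    tail-ab⊗c : (tail (a ⊗ b) ⊗ c) n ≡ a 0 * (tail b ⊗ c) n + (tail a ⊗ (b ⊗ c)) n
    tail-ab⊗c = trans (⊗-congˡ c (⊗-suc a b) n)
      (trans (⊗-distribʳ-⊕ (a 0 · tail b) (tail a ⊗ b) c n)
             (cong₂ _+_ (·-⊗ (a 0) (tail b) c n) (⊗-assoc (tail a) b c n)))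

^-cong : ∀ {a b} k → a ≈ₛ b → a ^ₛ k ≈ₛ b ^ₛ k
^-cong zero    a≈b = ≈ₛ-refl
^-cong (suc k) a≈b = ⊗-cong a≈b (^-cong k a≈b)

^-cong≤ : ∀ {a b} n k → (∀ i → i ≤ n → a i ≡ b i) → ∀ m → m ≤ n → (a ^ₛ k) m ≡ (b ^ₛ k) m
^-cong≤ n zero    a≡b m m≤n = refl
^-cong≤ n (suc k) a≡b m m≤n =
  ⊗-cong≤ m (λ i i≤m → a≡b i (ℕ.≤-trans i≤m m≤n)) (λ i i≤m → ^-cong≤ n k a≡b i (ℕ.≤-trans i≤m m≤n))

^-vanish : ∀ h → h 0 ≡ 0ℚ → ∀ k m → m < k → (h ^ₛ k) m ≡ 0ℚ
^-vanish h h0≡0 (suc k) m (s≤s m≤k) = sumTo-zero m _ (term≡0 m m≤k)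
  where
    term≡0 : ∀ m → m ≤ k → ∀ i → i ≤ m → h i * (h ^ₛ k) (m ∸ i) ≡ 0ℚ
    term≡0 m       _   zero    _         = trans (cong (_* (h ^ₛ k) m) h0≡0) (ℚ.*-zeroˡ ((h ^ₛ k) m))
    term≡0 (suc m) m<k (suc i) (s≤s i≤m) = trans
      (cong (h (suc i) *_) (^-vanish h h0≡0 k (m ∸ i) (ℕ.≤-<-trans (ℕ.m∸n≤m m i) m<k)))
      (ℚ.*-zeroʳ (h (suc i)))

shift^ : ℕ → Series → Series
shift^ zero    a = a
shift^ (suc k) a = shift (shift^ k a)

shift^-cong : ∀ {a b} k → a ≈ₛ b → shift^ k a ≈ₛ shift^ k b
shift^-cong zero    a≈b = a≈b
shift^-cong (suc k) a≈b = shift-cong (shift^-cong k a≈b)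

⊗-shift^ : ∀ a b k → a ⊗ shift^ k b ≈ₛ shift^ k (a ⊗ b)
⊗-shift^ a b zero    = ≈ₛ-refl
⊗-shift^ a b (suc k) = ≈ₛ-trans (⊗-shift a (shift^ k b)) (shift-cong (⊗-shift^ a b k))

shift^-+ : ∀ a k d → shift^ k a (k ℕ.+ d) ≡ a d
shift^-+ a zero    d = refl
shift^-+ a (suc k) d = shift^-+ a k d

shift^-< : ∀ a k n → n < k → shift^ k a n ≡ 0ℚ
shift^-< a (suc k) zero    _         = refl
shift^-< a (suc k) (suc n) (s≤s n<k) = shift^-< a k n n<k

∘-congˡ : ∀ {a b} h → a ≈ₛ b → a ∘ₛ h ≈ₛ b ∘ₛ h
∘-congˡ h a≈b n = sumTo-cong n (λ k → cong (_* (h ^ₛ k) n) (a≈b k))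

∘-congʳ : ∀ a {h h′} → h ≈ₛ h′ → a ∘ₛ h ≈ₛ a ∘ₛ h′
∘-congʳ a h≈h′ n = sumTo-cong n (λ k → cong (a k *_) (^-cong k h≈h′ n))

∘-distribʳ-⊕ : ∀ a b h → (a ⊕ b) ∘ₛ h ≈ₛ a ∘ₛ h ⊕ b ∘ₛ h
∘-distribʳ-⊕ a b h n = trans (sumTo-cong n (λ k → ℚ.*-distribʳ-+ ((h ^ₛ k) n) (a k) (b k))) (sumTo-+ n _ _)

oneₛ-∘ : ∀ h → oneₛ ∘ₛ h ≈ₛ oneₛ
oneₛ-∘ h zero    = ℚ.*-identityˡ 1ℚ
oneₛ-∘ h (suc n) = trans (sumTo-suc-head n (λ k → oneₛ k * (h ^ₛ k) (suc n)))
  (trans (cong₂ _+_ (ℚ.*-identityˡ 0ℚ) (sumTo-zero n _ (λ k _ → ℚ.*-zeroˡ ((h ^ₛ suc k) (suc n)))))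
         (ℚ.+-identityʳ 0ℚ))

∘-extend : ∀ a h → h 0 ≡ 0ℚ → ∀ N n → n ≤ N → sumTo N (λ k → a k * (h ^ₛ k) n) ≡ (a ∘ₛ h) n
∘-extend a h h0≡0 N n n≤N =
  sumTo-extend N _ n≤N (λ k n<k → trans (cong (a k *_) (^-vanish h h0≡0 k n n<k)) (ℚ.*-zeroʳ (a k)))

shift-∘ : ∀ a h → h 0 ≡ 0ℚ → shift a ∘ₛ h ≈ₛ h ⊗ (a ∘ₛ h)
shift-∘ a h h0≡0 zero    = trans (ℚ.*-zeroˡ 1ℚ) (sym (trans (cong (_* (a ∘ₛ h) 0) h0≡0) (ℚ.*-zeroˡ ((a ∘ₛ h) 0))))
shift-∘ a h h0≡0 (suc n) = begin
  (shift a ∘ₛ h) (suc n)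
    ≡⟨ sumTo-suc-head n _ ⟩
  0ℚ * 1ℚ + sumTo n (λ k → a k * (h ⊗ (h ^ₛ k)) (suc n))
    ≡⟨ trans (cong (_+ rest) (ℚ.*-zeroˡ 1ℚ)) (ℚ.+-identityˡ rest) ⟩
  sumTo n (λ k → a k * sumTo (suc n) (λ i → h i * (h ^ₛ k) (suc n ∸ i)))
    ≡⟨ sumTo-cong n (λ k → sym (sumTo-*ˡ (suc n) (a k) _)) ⟩
  sumTo n (λ k → sumTo (suc n) (λ i → a k * (h i * (h ^ₛ k) (suc n ∸ i))))
    ≡⟨ sumTo-swap n (suc n) _ ⟩
  sumTo (suc n) (λ i → sumTo n (λ k → a k * (h i * (h ^ₛ k) (suc n ∸ i))))
    ≡⟨ sumTo-cong (suc n) factor-h ⟩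
  sumTo (suc n) (λ i → h i * sumTo n (λ k → a k * (h ^ₛ k) (suc n ∸ i)))
    ≡⟨ sumTo-cong≤ (suc n) complete ⟩
  (h ⊗ (a ∘ₛ h)) (suc n)
    ∎
  where
    open ≡-Reasoning
    rest = sumTo n (λ k → a k * (h ⊗ (h ^ₛ k)) (suc n))
    h0*≡0 : ∀ x → h 0 * x ≡ 0ℚ
    h0*≡0 x = trans (cong (_* x) h0≡0) (ℚ.*-zeroˡ x)
    factor-h : ∀ i → sumTo n (λ k → a k * (h i * (h ^ₛ k) (suc n ∸ i)))
                     ≡ h i * sumTo n (λ k → a k * (h ^ₛ k) (suc n ∸ i))
    factor-h i = trans
      (sumTo-cong n (λ k → solve 3 (λ x y z → x :* (y :* z) := y :* (x :* z)) refl (a k) (h i) ((h ^ₛ k) (suc n ∸ i))))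
      (sumTo-*ˡ n (h i) _)
    -- h 0 = 0 kills the i = 0 term; for i > 0 the terms with k > suc n ∸ i vanish.
    complete : ∀ i → i ≤ suc n → h i * sumTo n (λ k → a k * (h ^ₛ k) (suc n ∸ i)) ≡ h i * (a ∘ₛ h) (suc n ∸ i)
    complete zero    _         = trans (h0*≡0 _) (sym (h0*≡0 ((a ∘ₛ h) (suc n))))
    complete (suc i) (s≤s i≤n) = cong (h (suc i) *_) (∘-extend a h h0≡0 n (n ∸ i) (ℕ.m∸n≤m n i))

geomₛ∘-fixpoint : ∀ u → u 0 ≡ 0ℚ → geomₛ ∘ₛ u ≈ₛ oneₛ ⊕ u ⊗ (geomₛ ∘ₛ u)
geomₛ∘-fixpoint u u0≡0 = ≈ₛ-trans (∘-congˡ u geomₛ≈oneₛ⊕shift)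
  (≈ₛ-trans (∘-distribʳ-⊕ oneₛ (shift geomₛ) u) (⊕-cong (oneₛ-∘ u) (shift-∘ geomₛ u u0≡0)))
  where
    geomₛ≈oneₛ⊕shift : geomₛ ≈ₛ oneₛ ⊕ shift geomₛ
    geomₛ≈oneₛ⊕shift zero    = sym (ℚ.+-identityʳ 1ℚ)
    geomₛ≈oneₛ⊕shift (suc n) = sym (ℚ.+-identityˡ 1ℚ)

oneₛ⊖-⊗-geomₛ∘ : ∀ u → u 0 ≡ 0ℚ → (oneₛ ⊖ u) ⊗ (geomₛ ∘ₛ u) ≈ₛ oneₛ
oneₛ⊖-⊗-geomₛ∘ u u0≡0 n = begin
  ((oneₛ ⊖ u) ⊗ v) n                ≡⟨ ⊗-distribʳ-⊖ oneₛ u v n ⟩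
  (oneₛ ⊗ v) n - (u ⊗ v) n          ≡⟨ cong (_- (u ⊗ v) n) (trans (⊗-identityˡ v n) (geomₛ∘-fixpoint u u0≡0 n)) ⟩
  (oneₛ n + (u ⊗ v) n) - (u ⊗ v) n  ≡⟨ solve 2 (λ x y → (x :+ y) :- y := x) refl (oneₛ n) ((u ⊗ v) n) ⟩
  oneₛ n                            ∎
  where
    open ≡-Reasoning
    v = geomₛ ∘ₛ u

geomₛ∘tₛ≈geomₛ : geomₛ ∘ₛ tₛ ≈ₛ geomₛ
geomₛ∘tₛ≈geomₛ zero    = trans (geomₛ∘-fixpoint tₛ refl zero)
  (trans (cong (1ℚ +_) (tₛ-⊗ (geomₛ ∘ₛ tₛ) zero)) (ℚ.+-identityʳ 1ℚ))
geomₛ∘tₛ≈geomₛ (suc n) = trans (geomₛ∘-fixpoint tₛ refl (suc n))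
  (trans (cong (0ℚ +_) (tₛ-⊗ (geomₛ ∘ₛ tₛ) (suc n))) (trans (ℚ.+-identityˡ _) (geomₛ∘tₛ≈geomₛ n)))

-- Binomial coefficients

pascal : ∀ n k → ℕ→ℚ (suc n C suc k) ≡ ℕ→ℚ (n C k) + ℕ→ℚ (n C suc k)
pascal n k = trans (cong ℕ→ℚ (sym (nCk+nC[k+1]≡[n+1]C[k+1] n k))) (ℕ→ℚ-homo-+ (n C k) (n C suc k))

C-absorb : ∀ m k → suc k ℕ.* (suc m C suc k) ≡ suc m ℕ.* (m C k)
C-absorb zero    zero    = refl
C-absorb zero    (suc k) = ℕ.*-zeroʳ (suc (suc k))
C-absorb (suc m) zero    =
  trans (ℕ.+-identityʳ (suc (suc m) C 1)) (trans (nC1≡n (suc (suc m))) (sym (ℕ.*-identityʳ (suc (suc m)))))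
C-absorb (suc m) (suc k) = begin
  suc (suc k) ℕ.* (suc (suc m) C suc (suc k))
    ≡⟨ cong (suc (suc k) ℕ.*_) (nCk+nC[k+1]≡[n+1]C[k+1] (suc m) (suc k)) ⟨
  suc (suc k) ℕ.* (u ℕ.+ v)
    ≡⟨ expand k u v ⟩
  (suc k ℕ.* u ℕ.+ u) ℕ.+ suc (suc k) ℕ.* v
    ≡⟨ cong₂ (λ x y → x ℕ.+ u ℕ.+ y) (C-absorb m k) (C-absorb m (suc k)) ⟩
  (suc m ℕ.* (m C k) ℕ.+ u) ℕ.+ suc m ℕ.* (m C suc k)
    ≡⟨ collect m (m C k) (m C suc k) u ⟩
  suc m ℕ.* ((m C k) ℕ.+ (m C suc k)) ℕ.+ u
    ≡⟨ cong (λ x → suc m ℕ.* x ℕ.+ u) (nCk+nC[k+1]≡[n+1]C[k+1] m k) ⟩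
  suc m ℕ.* u ℕ.+ u
    ≡⟨ ℕ.+-comm (suc m ℕ.* u) u ⟩
  suc (suc m) ℕ.* u
    ∎
  where
    open ≡-Reasoning
    u = suc m C suc k
    v = suc m C suc (suc k)
    expand : ∀ k u v → suc (suc k) ℕ.* (u ℕ.+ v) ≡ (suc k ℕ.* u ℕ.+ u) ℕ.+ suc (suc k) ℕ.* v
    expand = solve-∀
    collect : ∀ m x y z → (suc m ℕ.* x ℕ.+ z) ℕ.+ suc m ℕ.* y ≡ suc m ℕ.* (x ℕ.+ y) ℕ.+ z
    collect = solve-∀

-- Power recurrences

record PowerRecurrence (p : ℕ) (H : Series) (X : ℕ → Series) : Set where
  field
    step : ∀ a → X (suc a) ≈ₛ X a ⊕ shift (H ⊗ X (a ℕ.+ p))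

open PowerRecurrence

powerRecurrence-oneₛ : ∀ {p X} → (∀ a → X (suc a) 0 ≡ X a 0) →
                       (∀ a n → X (suc a) (suc n) ≡ X a (suc n) + X (a ℕ.+ p) n) →
                       PowerRecurrence p oneₛ X
powerRecurrence-oneₛ {p} {X} head-step coeff-step = record { step = step′ }
  where
    step′ : ∀ a → X (suc a) ≈ₛ X a ⊕ shift (oneₛ ⊗ X (a ℕ.+ p))
    step′ a zero    = trans (head-step a) (sym (ℚ.+-identityʳ (X a 0)))
    step′ a (suc n) = trans (coeff-step a n) (cong (X a (suc n) +_) (sym (⊗-identityˡ (X (a ℕ.+ p)) n)))

powerRecurrence-head : ∀ {p H X} → PowerRecurrence p H X → ∀ a → X a 0 ≡ X 0 0
powerRecurrence-head         rec zero    = refl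
powerRecurrence-head {X = X} rec (suc a) =
  trans (step rec a 0) (trans (ℚ.+-identityʳ (X a 0)) (powerRecurrence-head rec a))

powerRecurrence-unique : ∀ {p H X Y} → PowerRecurrence p H X → PowerRecurrence p H Y → X 0 ≈ₛ Y 0 →
                         ∀ a → X a ≈ₛ Y a
powerRecurrence-unique {p} {H} {X} {Y} recX recY X0≈Y0 a n = agree n a n ℕ.≤-refl
  where
    open ≡-Reasoning
    agree : ∀ m a j → j ≤ m → X a j ≡ Y a j
    agree m       a       zero    _         =
      trans (powerRecurrence-head recX a) (trans (X0≈Y0 0) (sym (powerRecurrence-head recY a)))
    agree (suc m) zero    (suc j) _         = X0≈Y0 (suc j)
    agree (suc m) (suc a) (suc j) (s≤s j≤m) = begin
      X (suc a) (suc j)                  ≡⟨ step recX a (suc j) ⟩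
      X a (suc j) + (H ⊗ X (a ℕ.+ p)) j  ≡⟨ cong₂ _+_ (agree (suc m) a (suc j) (s≤s j≤m)) lower ⟩
      Y a (suc j) + (H ⊗ Y (a ℕ.+ p)) j  ≡⟨ step recY a (suc j) ⟨
      Y (suc a) (suc j)                  ∎
      where
        lower : (H ⊗ X (a ℕ.+ p)) j ≡ (H ⊗ Y (a ℕ.+ p)) j
        lower = ⊗-cong≤ j {H} (λ _ _ → refl) (λ i i≤j → agree m (a ℕ.+ p) i (ℕ.≤-trans i≤j j≤m))

fixpoint-unique : ∀ p {v w} → v 0 ≡ 0ℚ → w 0 ≡ 0ℚ →
                  v ≈ₛ tₛ ⊗ (oneₛ ⊕ v) ^ₛ p → w ≈ₛ tₛ ⊗ (oneₛ ⊕ w) ^ₛ p → v ≈ₛ w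
fixpoint-unique p {v} {w} v0≡0 w0≡0 v-fix w-fix n = agree n n ℕ.≤-refl
  where
    open ≡-Reasoning
    agree : ∀ m j → j ≤ m → v j ≡ w j
    agree m       zero    _         = trans v0≡0 (sym w0≡0)
    agree (suc m) (suc j) (s≤s j≤m) = begin
      v (suc j)            ≡⟨ trans (v-fix (suc j)) (tₛ-⊗ ((oneₛ ⊕ v) ^ₛ p) (suc j)) ⟩
      ((oneₛ ⊕ v) ^ₛ p) j  ≡⟨ ^-cong≤ m p (λ i i≤m → cong (oneₛ i +_) (agree m i i≤m)) j j≤m ⟩
      ((oneₛ ⊕ w) ^ₛ p) j  ≡⟨ trans (w-fix (suc j)) (tₛ-⊗ ((oneₛ ⊕ w) ^ₛ p) (suc j)) ⟨
      w (suc j)            ∎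

geom^ : ℕ → Series
geom^ zero    zero    = 1ℚ
geom^ zero    (suc n) = 0ℚ
geom^ (suc a) zero    = 1ℚ
geom^ (suc a) (suc n) = geom^ a (suc n) + geom^ (suc a) n

geom^0≈oneₛ : geom^ 0 ≈ₛ oneₛ
geom^0≈oneₛ zero    = refl
geom^0≈oneₛ (suc n) = refl

geom^1≈geomₛ : geom^ 1 ≈ₛ geomₛ
geom^1≈geomₛ zero    = refl
geom^1≈geomₛ (suc n) = trans (ℚ.+-identityˡ (geom^ 1 n)) (geom^1≈geomₛ n)

geom^-suc : ∀ a → geom^ (suc a) ≈ₛ geom^ a ⊕ shift (geom^ (suc a))
geom^-suc zero    zero    = sym (ℚ.+-identityʳ 1ℚ)
geom^-suc (suc a) zero    = sym (ℚ.+-identityʳ 1ℚ)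
geom^-suc a       (suc n) = refl

[oneₛ⊖tₛ]-⊗ : ∀ a → (oneₛ ⊖ tₛ) ⊗ a ≈ₛ a ⊖ shift a
[oneₛ⊖tₛ]-⊗ a n = trans (⊗-distribʳ-⊖ oneₛ tₛ a n) (cong₂ _-_ (⊗-identityˡ a n) (tₛ-⊗ a n))

[oneₛ⊖tₛ]-⊗-geom^-suc : ∀ a → (oneₛ ⊖ tₛ) ⊗ geom^ (suc a) ≈ₛ geom^ a
[oneₛ⊖tₛ]-⊗-geom^-suc a n = trans ([oneₛ⊖tₛ]-⊗ (geom^ (suc a)) n)
  (trans (cong (_- shift (geom^ (suc a)) n) (geom^-suc a n))
         (solve 2 (λ x y → (x :+ y) :- y := x) refl (geom^ a n) (shift (geom^ (suc a)) n)))

[oneₛ⊖tₛ]^-⊗-geom^ : ∀ m a → (oneₛ ⊖ tₛ) ^ₛ m ⊗ geom^ (a ℕ.+ m) ≈ₛ geom^ a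
[oneₛ⊖tₛ]^-⊗-geom^ zero    a =
  ≈ₛ-trans (⊗-identityˡ (geom^ (a ℕ.+ 0))) (λ n → cong (λ b → geom^ b n) (ℕ.+-identityʳ a))
[oneₛ⊖tₛ]^-⊗-geom^ (suc m) a = begin
  (O ⊗ O ^ₛ m) ⊗ geom^ (a ℕ.+ suc m)     ≈⟨ ⊗-congˡ (geom^ (a ℕ.+ suc m)) (⊗-comm O (O ^ₛ m)) ⟩
  (O ^ₛ m ⊗ O) ⊗ geom^ (a ℕ.+ suc m)     ≈⟨ ⊗-assoc (O ^ₛ m) O (geom^ (a ℕ.+ suc m)) ⟩
  O ^ₛ m ⊗ (O ⊗ geom^ (a ℕ.+ suc m))     ≈⟨ ⊗-congʳ (O ^ₛ m) (λ n → cong (λ b → (O ⊗ geom^ b) n) (ℕ.+-suc a m)) ⟩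
  O ^ₛ m ⊗ (O ⊗ geom^ (suc (a ℕ.+ m)))   ≈⟨ ⊗-congʳ (O ^ₛ m) ([oneₛ⊖tₛ]-⊗-geom^-suc (a ℕ.+ m)) ⟩
  O ^ₛ m ⊗ geom^ (a ℕ.+ m)               ≈⟨ [oneₛ⊖tₛ]^-⊗-geom^ m a ⟩
  geom^ a                                ∎
  where
    open ≈ₛ-Reasoning
    O = oneₛ ⊖ tₛ

-- With x = C(pN, N), y = C(pN, N-1) and q = p - 1, the hypothesis is the absorption identity
-- N·C(pN+1, N) = (pN+1)·C(pN, N-1); the ring solver cannot use it, so it is substituted by hand.
F-coefficient-identity : ∀ x y n q → n * (y + x) ≡ (1ℚ + (1ℚ + q) * n) * y →
                         x ≡ ((y + x) - (1ℚ + q) * y) * (1ℚ + q * n)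
F-coefficient-identity x y n q absorption = sym (begin
  ((y + x) - (1ℚ + q) * y) * (1ℚ + q * n)
    ≡⟨ solve 4 (λ x y n q → ((y :+ x) :- (con 1ℚ :+ q) :* y) :* (con 1ℚ :+ q :* n)
                            := x :+ q :* (n :* (y :+ x) :- (con 1ℚ :+ (con 1ℚ :+ q) :* n) :* y)) refl x y n q ⟩
  x + q * (n * (y + x) - z)
    ≡⟨ cong (λ u → x + q * (u - z)) absorption ⟩
  x + q * (z - z)
    ≡⟨ solve 3 (λ x z q → x :+ q :* (z :- z) := x) refl x z q ⟩
  x
    ∎)
  where
    open ≡-Reasoning
    z = (1ℚ + (1ℚ + q) * n) * y

f̃-coefficient-identity : ∀ x y n q → n * (y + x) ≡ (1ℚ + (1ℚ + q) * n) * y →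
                         y + x ≡ ((y + x) - (1ℚ + q) * y) * (1ℚ + (1ℚ + q) * n)
f̃-coefficient-identity x y n q absorption = sym (begin
  ((y + x) - (1ℚ + q) * y) * (1ℚ + (1ℚ + q) * n)
    ≡⟨ solve 4 (λ x y n q → ((y :+ x) :- (con 1ℚ :+ q) :* y) :* (con 1ℚ :+ (con 1ℚ :+ q) :* n)
                            := (y :+ x) :+ (con 1ℚ :+ q) :* (n :* (y :+ x) :- (con 1ℚ :+ (con 1ℚ :+ q) :* n) :* y))
             refl x y n q ⟩
  (y + x) + (1ℚ + q) * (n * (y + x) - z)
    ≡⟨ cong (λ u → (y + x) + (1ℚ + q) * (u - z)) absorption ⟩
  (y + x) + (1ℚ + q) * (z - z)
    ≡⟨ solve 3 (λ x z q → x :+ q :* (z :- z) := x) refl (y + x) z (1ℚ + q) ⟩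
  y + x
    ∎)
  where
    open ≡-Reasoning
    z = (1ℚ + (1ℚ + q) * n) * y

-- Powers of the Fuss–Catalan series

module FussCatalan (q : ℕ) where

  p : ℕ
  p = suc q

  -- F^ a is the series F_p^a.
  F^ : ℕ → Series
  F^ a       zero    = 1ℚ
  F^ zero    (suc n) = 0ℚ
  F^ (suc a) (suc n) = F^ a (suc n) + F^ (a ℕ.+ p) n

  F^-recurrence : PowerRecurrence p oneₛ F^
  F^-recurrence = powerRecurrence-oneₛ (λ _ → refl) (λ _ _ → refl)

  F^0≈oneₛ : F^ 0 ≈ₛ oneₛ
  F^0≈oneₛ zero    = refl
  F^0≈oneₛ (suc n) = refl

  F^-⊗ : ∀ {X} → PowerRecurrence p oneₛ X → ∀ a b → F^ a ⊗ X b ≈ₛ X (a ℕ.+ b)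
  F^-⊗ {X} recX a b = powerRecurrence-unique left right base a
    where
      open ≈ₛ-Reasoning
      left : PowerRecurrence p oneₛ (λ a → F^ a ⊗ X b)
      left = record { step = λ a → begin
        F^ (suc a) ⊗ X b                                  ≈⟨ ⊗-congˡ (X b) (step F^-recurrence a) ⟩
        (F^ a ⊕ shift (oneₛ ⊗ F^ (a ℕ.+ p))) ⊗ X b        ≈⟨ ⊗-distribʳ-⊕ (F^ a) _ (X b) ⟩
        F^ a ⊗ X b ⊕ shift (oneₛ ⊗ F^ (a ℕ.+ p)) ⊗ X b    ≈⟨ ⊕-congˡ (F^ a ⊗ X b) (shift-⊗ (oneₛ ⊗ F^ (a ℕ.+ p)) (X b)) ⟩
        F^ a ⊗ X b ⊕ shift ((oneₛ ⊗ F^ (a ℕ.+ p)) ⊗ X b)  ≈⟨ ⊕-congˡ (F^ a ⊗ X b) (shift-cong (⊗-assoc oneₛ (F^ (a ℕ.+ p)) (X b))) ⟩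
        F^ a ⊗ X b ⊕ shift (oneₛ ⊗ (F^ (a ℕ.+ p) ⊗ X b))  ∎ }
      reorder : ∀ a b c → (a ℕ.+ b) ℕ.+ c ≡ (a ℕ.+ c) ℕ.+ b
      reorder = solve-∀
      right : PowerRecurrence p oneₛ (λ a → X (a ℕ.+ b))
      right = record { step = λ a n → trans (step recX (a ℕ.+ b) n)
        (cong (λ c → (X (a ℕ.+ b) ⊕ shift (oneₛ ⊗ X c)) n) (reorder a b p)) }
      base : F^ 0 ⊗ X b ≈ₛ X b
      base = ≈ₛ-trans (⊗-congˡ (X b) F^0≈oneₛ) (⊗-identityˡ (X b))

  F^-⊗-F^ : ∀ a b → F^ a ⊗ F^ b ≈ₛ F^ (a ℕ.+ b)
  F^-⊗-F^ = F^-⊗ F^-recurrence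

  F^1-^ : ∀ k → F^ 1 ^ₛ k ≈ₛ F^ k
  F^1-^ zero    = ≈ₛ-sym F^0≈oneₛ
  F^1-^ (suc k) = ≈ₛ-trans (⊗-congʳ (F^ 1) (F^1-^ k)) (F^-⊗-F^ 1 k)

  -- [t^n] F_p^a = C(a+pn, n) - p·C(a+pn-1, n-1) for n ≥ 1; here m = a + pn - 1.
  F^-closed : ℕ → Series
  F^-closed a zero    = 1ℚ
  F^-closed a (suc n) = ℕ→ℚ (suc m C suc n) - ℕ→ℚ p * ℕ→ℚ (m C n)
    where m = a ℕ.+ (n ℕ.+ q ℕ.* suc n)

  F^-closed-recurrence : PowerRecurrence p oneₛ F^-closed
  F^-closed-recurrence = powerRecurrence-oneₛ (λ _ → refl) coeff-step
    where
      open ≡-Reasoning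
      index : ∀ a n q → (a ℕ.+ suc q) ℕ.+ (n ℕ.+ q ℕ.* suc n) ≡ a ℕ.+ (suc n ℕ.+ q ℕ.* suc (suc n))
      index = solve-∀
      coeff-step : ∀ a n → F^-closed (suc a) (suc n) ≡ F^-closed a (suc n) + F^-closed (a ℕ.+ p) n
      coeff-step a zero = begin
        ℕ→ℚ (suc (suc m) C 1) - ℕ→ℚ p * ℕ→ℚ 1   ≡⟨ cong (λ z → ℕ→ℚ z - ℕ→ℚ p * ℕ→ℚ 1) (nC1≡n (suc (suc m))) ⟩
        ℕ→ℚ (suc (suc m)) - ℕ→ℚ p * ℕ→ℚ 1       ≡⟨ cong (_- ℕ→ℚ p * ℕ→ℚ 1) (ℕ→ℚ-suc (suc m)) ⟩
        (1ℚ + ℕ→ℚ (suc m)) - ℕ→ℚ p * ℕ→ℚ 1      ≡⟨ solve 2 (λ x y → (con 1ℚ :+ x) :- y := x :- y :+ con 1ℚ) refl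
                                                          (ℕ→ℚ (suc m)) (ℕ→ℚ p * ℕ→ℚ 1) ⟩
        (ℕ→ℚ (suc m) - ℕ→ℚ p * ℕ→ℚ 1) + 1ℚ      ≡⟨ cong (λ z → (ℕ→ℚ z - ℕ→ℚ p * ℕ→ℚ 1) + 1ℚ) (nC1≡n (suc m)) ⟨
        (ℕ→ℚ (suc m C 1) - ℕ→ℚ p * ℕ→ℚ 1) + 1ℚ  ∎
        where m = a ℕ.+ (0 ℕ.+ q ℕ.* 1)
      coeff-step a (suc n) = begin
        ℕ→ℚ (suc (suc m) C suc (suc n)) - P * ℕ→ℚ (suc m C suc n)
          ≡⟨ cong₂ (λ x y → x - P * y) (pascal (suc m) (suc n)) (pascal m n) ⟩
        (ℕ→ℚ (suc m C suc n) + ℕ→ℚ (suc m C suc (suc n))) - P * (ℕ→ℚ (m C n) + ℕ→ℚ (m C suc n))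
          ≡⟨ solve 5 (λ x₁ x₂ y₁ y₂ z → (x₁ :+ x₂) :- z :* (y₁ :+ y₂) := (x₂ :- z :* y₂) :+ (x₁ :- z :* y₁)) refl
                   (ℕ→ℚ (suc m C suc n)) (ℕ→ℚ (suc m C suc (suc n))) (ℕ→ℚ (m C n)) (ℕ→ℚ (m C suc n)) P ⟩
        (ℕ→ℚ (suc m C suc (suc n)) - P * ℕ→ℚ (m C suc n)) + (ℕ→ℚ (suc m C suc n) - P * ℕ→ℚ (m C n))
          ≡⟨ cong (λ k → F^-closed a (suc (suc n)) + (ℕ→ℚ (suc k C suc n) - P * ℕ→ℚ (k C n))) (index a n q) ⟨
        F^-closed a (suc (suc n)) + F^-closed (a ℕ.+ p) (suc n)
          ∎
        where
          m = a ℕ.+ (suc n ℕ.+ q ℕ.* suc (suc n))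
          P = ℕ→ℚ p

  F^-closed0≈oneₛ : F^-closed 0 ≈ₛ oneₛ
  F^-closed0≈oneₛ zero    = refl
  F^-closed0≈oneₛ (suc n) = begin
    ℕ→ℚ (suc m C suc n) - ℕ→ℚ p * ℕ→ℚ (m C n)  ≡⟨ cong (λ z → ℕ→ℚ z - ℕ→ℚ p * ℕ→ℚ (m C n)) C≡p*C ⟩
    ℕ→ℚ (p ℕ.* (m C n)) - ℕ→ℚ p * ℕ→ℚ (m C n)  ≡⟨ cong (_- ℕ→ℚ p * ℕ→ℚ (m C n)) (ℕ→ℚ-homo-* p (m C n)) ⟩
    ℕ→ℚ p * ℕ→ℚ (m C n) - ℕ→ℚ p * ℕ→ℚ (m C n)  ≡⟨ ℚ.+-inverseʳ (ℕ→ℚ p * ℕ→ℚ (m C n)) ⟩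
    0ℚ                                         ∎
    where
      open ≡-Reasoning
      m = n ℕ.+ q ℕ.* suc n
      C≡p*C : suc m C suc n ≡ p ℕ.* (m C n)
      C≡p*C = ℕ.*-cancelˡ-≡ (suc m C suc n) (p ℕ.* (m C n)) (suc n)
        (trans (C-absorb m n) (trans (cong (ℕ._* (m C n)) (ℕ.*-comm p (suc n))) (ℕ.*-assoc (suc n) p (m C n))))

  F^≈F^-closed : ∀ a → F^ a ≈ₛ F^-closed a
  F^≈F^-closed =
    powerRecurrence-unique F^-recurrence F^-closed-recurrence (≈ₛ-trans F^0≈oneₛ (≈ₛ-sym F^-closed0≈oneₛ))

  absorption : ∀ n → ℕ→ℚ (suc n) * (ℕ→ℚ (p ℕ.* suc n C n) + ℕ→ℚ (p ℕ.* suc n C suc n))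
                     ≡ (1ℚ + (1ℚ + ℕ→ℚ q) * ℕ→ℚ (suc n)) * ℕ→ℚ (p ℕ.* suc n C n)
  absorption n = begin
    ℕ→ℚ N * (ℕ→ℚ y + ℕ→ℚ x)              ≡⟨ cong (ℕ→ℚ N *_) (pascal (p ℕ.* N) n) ⟨
    ℕ→ℚ N * ℕ→ℚ (suc (p ℕ.* N) C N)      ≡⟨ ℕ→ℚ-homo-* N (suc (p ℕ.* N) C N) ⟨
    ℕ→ℚ (N ℕ.* (suc (p ℕ.* N) C N))      ≡⟨ cong ℕ→ℚ (C-absorb (p ℕ.* N) n) ⟩
    ℕ→ℚ (suc (p ℕ.* N) ℕ.* y)            ≡⟨ ℕ→ℚ-homo-* (suc (p ℕ.* N)) y ⟩
    ℕ→ℚ (suc (p ℕ.* N)) * ℕ→ℚ y          ≡⟨ cong (_* ℕ→ℚ y) (ℕ→ℚ-suc-* p N) ⟩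
    (1ℚ + ℕ→ℚ p * ℕ→ℚ N) * ℕ→ℚ y         ≡⟨ cong (λ z → (1ℚ + z * ℕ→ℚ N) * ℕ→ℚ y) (ℕ→ℚ-suc q) ⟩
    (1ℚ + (1ℚ + ℕ→ℚ q) * ℕ→ℚ N) * ℕ→ℚ y  ∎
    where
      open ≡-Reasoning
      N = suc n
      x = p ℕ.* N C N
      y = p ℕ.* N C n

  Fₚ≈F^1 : Fₚ p ≈ₛ F^ 1
  Fₚ≈F^1 zero    = a≡x*d⇒a/d≡x 1 (q ℕ.* 0) 1ℚ
    (sym (trans (cong (λ k → 1ℚ * ℕ→ℚ (suc k)) (ℕ.*-zeroʳ q)) (ℚ.*-identityˡ 1ℚ)))
  Fₚ≈F^1 (suc n) = trans (a≡x*d⇒a/d≡x x (q ℕ.* N) (F^-closed 1 N) coefficient) (sym (F^≈F^-closed 1 N))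
    where
      open ≡-Reasoning
      N = suc n
      x = p ℕ.* N C N
      y = p ℕ.* N C n
      coefficient : ℕ→ℚ x ≡ F^-closed 1 N * ℕ→ℚ (suc (q ℕ.* N))
      coefficient = begin
        ℕ→ℚ x
          ≡⟨ F-coefficient-identity (ℕ→ℚ x) (ℕ→ℚ y) (ℕ→ℚ N) (ℕ→ℚ q) (absorption n) ⟩
        ((ℕ→ℚ y + ℕ→ℚ x) - (1ℚ + ℕ→ℚ q) * ℕ→ℚ y) * (1ℚ + ℕ→ℚ q * ℕ→ℚ N)
          ≡⟨ cong₂ (λ u v → (u - v * ℕ→ℚ y) * (1ℚ + ℕ→ℚ q * ℕ→ℚ N)) (pascal (p ℕ.* N) n) (ℕ→ℚ-suc q) ⟨
        F^-closed 1 N * (1ℚ + ℕ→ℚ q * ℕ→ℚ N)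
          ≡⟨ cong (F^-closed 1 N *_) (ℕ→ℚ-suc-* q N) ⟨
        F^-closed 1 N * ℕ→ℚ (suc (q ℕ.* N))
          ∎

  f̃≈shift-F^p : f̃ p ≈ₛ shift (F^ p)
  f̃≈shift-F^p zero    = refl
  f̃≈shift-F^p (suc n) = trans (a≡x*d⇒a/d≡x (suc (p ℕ.* N) C N) (p ℕ.* N) (F^-closed 1 N) coefficient)
                              (trans (sym (F^≈F^-closed 1 N)) (ℚ.+-identityˡ (F^ p n)))
    where
      open ≡-Reasoning
      N = suc n
      x = p ℕ.* N C N
      y = p ℕ.* N C n
      coefficient : ℕ→ℚ (suc (p ℕ.* N) C N) ≡ F^-closed 1 N * ℕ→ℚ (suc (p ℕ.* N))
      coefficient = begin
        ℕ→ℚ (suc (p ℕ.* N) C N)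
          ≡⟨ pascal (p ℕ.* N) n ⟩
        ℕ→ℚ y + ℕ→ℚ x
          ≡⟨ f̃-coefficient-identity (ℕ→ℚ x) (ℕ→ℚ y) (ℕ→ℚ N) (ℕ→ℚ q) (absorption n) ⟩
        ((ℕ→ℚ y + ℕ→ℚ x) - (1ℚ + ℕ→ℚ q) * ℕ→ℚ y) * (1ℚ + (1ℚ + ℕ→ℚ q) * ℕ→ℚ N)
          ≡⟨ cong₂ (λ u v → (u - v * ℕ→ℚ y) * (1ℚ + v * ℕ→ℚ N)) (pascal (p ℕ.* N) n) (ℕ→ℚ-suc q) ⟨
        F^-closed 1 N * (1ℚ + ℕ→ℚ p * ℕ→ℚ N)
          ≡⟨ cong (F^-closed 1 N *_) (ℕ→ℚ-suc-* p N) ⟨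
        F^-closed 1 N * ℕ→ℚ (suc (p ℕ.* N))
          ∎

  Fₚ^≈F^ : ∀ k → Fₚ p ^ₛ k ≈ₛ F^ k
  Fₚ^≈F^ k = ≈ₛ-trans (^-cong k Fₚ≈F^1) (F^1-^ k)

  f̃≈Fₚ⊖oneₛ : f̃ p ≈ₛ Fₚ p ⊖ oneₛ
  f̃≈Fₚ⊖oneₛ zero    = sym (trans (cong (_- 1ℚ) (Fₚ≈F^1 0)) (ℚ.+-inverseʳ 1ℚ))
  f̃≈Fₚ⊖oneₛ (suc n) = trans (f̃≈shift-F^p (suc n)) (sym (begin
    Fₚ p (suc n) - 0ℚ   ≡⟨ cong (_- 0ℚ) (Fₚ≈F^1 (suc n)) ⟩
    F^ 1 (suc n) - 0ℚ   ≡⟨ ℚ.+-identityʳ (F^ 1 (suc n)) ⟩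
    0ℚ + F^ p n         ≡⟨ ℚ.+-identityˡ (F^ p n) ⟩
    F^ p n              ∎))
    where open ≡-Reasoning

  f̃≈tₛ⊗Fₚ^p : f̃ p ≈ₛ tₛ ⊗ Fₚ p ^ₛ p
  f̃≈tₛ⊗Fₚ^p = ≈ₛ-trans f̃≈shift-F^p (≈ₛ-sym (≈ₛ-trans (⊗-congʳ tₛ (Fₚ^≈F^ p)) (tₛ-⊗ (F^ p))))

  f̃^≈shift^ : ∀ k → f̃ p ^ₛ k ≈ₛ shift^ k (F^ (p ℕ.* k))
  f̃^≈shift^ zero    = ≈ₛ-trans (≈ₛ-sym F^0≈oneₛ) (λ n → cong (λ a → F^ a n) (sym (ℕ.*-zeroʳ p)))
  f̃^≈shift^ (suc k) = begin
    f̃ p ⊗ f̃ p ^ₛ k                           ≈⟨ ⊗-cong f̃≈shift-F^p (f̃^≈shift^ k) ⟩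
    shift (F^ p) ⊗ shift^ k (F^ (p ℕ.* k))    ≈⟨ shift-⊗ (F^ p) (shift^ k (F^ (p ℕ.* k))) ⟩
    shift (F^ p ⊗ shift^ k (F^ (p ℕ.* k)))    ≈⟨ shift-cong (⊗-shift^ (F^ p) (F^ (p ℕ.* k)) k) ⟩
    shift (shift^ k (F^ p ⊗ F^ (p ℕ.* k)))    ≈⟨ shift-cong (shift^-cong k (F^-⊗-F^ p (p ℕ.* k))) ⟩
    shift (shift^ k (F^ (p ℕ.+ p ℕ.* k)))     ≈⟨ shift-cong (shift^-cong k (λ n → cong (λ a → F^ a n) (sym (ℕ.*-suc p k)))) ⟩
    shift^ (suc k) (F^ (p ℕ.* suc k))         ∎
    where open ≈ₛ-Reasoning

  g̃-recurrence : PowerRecurrence p oneₛ (g̃ p)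
  g̃-recurrence = powerRecurrence-oneₛ (λ _ → refl) coeff-step
    where
      open ≡-Reasoning
      index : ∀ q n b → suc q ℕ.* n ℕ.+ (b ℕ.+ suc q) ≡ suc q ℕ.* suc n ℕ.+ b
      index = solve-∀
      coeff-step : ∀ b n → g̃ p (suc b) (suc n) ≡ g̃ p b (suc n) + g̃ p (b ℕ.+ p) n
      coeff-step b n = begin
        ℕ→ℚ ((p ℕ.* suc n ℕ.+ suc b) C suc n)                ≡⟨ cong (λ k → ℕ→ℚ (k C suc n)) (ℕ.+-suc (p ℕ.* suc n) b) ⟩
        ℕ→ℚ (suc m C suc n)                                  ≡⟨ pascal m n ⟩
        ℕ→ℚ (m C n) + ℕ→ℚ (m C suc n)                        ≡⟨ ℚ.+-comm (ℕ→ℚ (m C n)) (ℕ→ℚ (m C suc n)) ⟩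
        ℕ→ℚ (m C suc n) + ℕ→ℚ (m C n)                        ≡⟨ cong (λ k → ℕ→ℚ (m C suc n) + ℕ→ℚ (k C n)) (index q n b) ⟨
        ℕ→ℚ (m C suc n) + ℕ→ℚ ((p ℕ.* n ℕ.+ (b ℕ.+ p)) C n)  ∎
        where m = p ℕ.* suc n ℕ.+ b

  g̃-⊗-F^ : ∀ r b → g̃ p r ⊗ F^ b ≈ₛ g̃ p (b ℕ.+ r)
  g̃-⊗-F^ r b = ≈ₛ-trans (⊗-comm (g̃ p r) (F^ b)) (F^-⊗ g̃-recurrence b r)

  shift^-g̃≡d̃ : ∀ r n k → shift^ k (g̃ p (p ℕ.* k ℕ.+ r)) n ≡ d̃ p r n k
  shift^-g̃≡d̃ r n k with k ℕ.≤? n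
  ... | no k≰n = trans (shift^-< (g̃ p (p ℕ.* k ℕ.+ r)) k n (ℕ.≰⇒> k≰n)) (sym (cong ℕ→ℚ (k>n⇒nCk≡0 pn+r<qn+r+k)))
    where
      split : ∀ n s r → (n ℕ.+ s) ℕ.+ r ≡ (s ℕ.+ r) ℕ.+ n
      split = solve-∀
      pn+r<qn+r+k : p ℕ.* n ℕ.+ r < q ℕ.* n ℕ.+ r ℕ.+ k
      pn+r<qn+r+k = subst (_< q ℕ.* n ℕ.+ r ℕ.+ k) (sym (split n (q ℕ.* n) r))
                          (ℕ.+-monoʳ-< (q ℕ.* n ℕ.+ r) (ℕ.≰⇒> k≰n))
  ... | yes k≤n with ℕ.m≤n⇒∃[o]m+o≡n k≤n
  ...   | d , refl = begin
    shift^ k (g̃ p (p ℕ.* k ℕ.+ r)) (k ℕ.+ d)  ≡⟨ shift^-+ (g̃ p (p ℕ.* k ℕ.+ r)) k d ⟩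
    ℕ→ℚ ((p ℕ.* d ℕ.+ (p ℕ.* k ℕ.+ r)) C d)   ≡⟨ cong (λ m → ℕ→ℚ (m C d)) (index₁ q k d r) ⟩
    ℕ→ℚ ((K ℕ.+ d) C d)                        ≡⟨ cong (λ m → ℕ→ℚ ((K ℕ.+ d) C m)) (ℕ.m+n∸m≡n K d) ⟨
    ℕ→ℚ ((K ℕ.+ d) C ((K ℕ.+ d) ∸ K))          ≡⟨ cong ℕ→ℚ (nCk≡nC[n∸k] (ℕ.m≤m+n K d)) ⟨
    ℕ→ℚ ((K ℕ.+ d) C K)                        ≡⟨ cong (λ m → ℕ→ℚ (m C K)) (index₂ q k d r) ⟨
    d̃ p r (k ℕ.+ d) k                          ∎
    where
      open ≡-Reasoning
      K = q ℕ.* (k ℕ.+ d) ℕ.+ r ℕ.+ k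
      index₁ : ∀ q k d r → suc q ℕ.* d ℕ.+ (suc q ℕ.* k ℕ.+ r) ≡ (q ℕ.* (k ℕ.+ d) ℕ.+ r ℕ.+ k) ℕ.+ d
      index₁ = solve-∀
      index₂ : ∀ q k d r → suc q ℕ.* (k ℕ.+ d) ℕ.+ r ≡ (q ℕ.* (k ℕ.+ d) ℕ.+ r ℕ.+ k) ℕ.+ d
      index₂ = solve-∀

  d̃-isRiordanArray : ∀ r → IsRiordanArray (d̃ p r) (g̃ p r) (f̃ p)
  d̃-isRiordanArray r n k = sym (begin
    (g̃ p r ⊗ f̃ p ^ₛ k) n                ≡⟨ ⊗-congʳ (g̃ p r) (f̃^≈shift^ k) n ⟩
    (g̃ p r ⊗ shift^ k (F^ (p ℕ.* k))) n  ≡⟨ ⊗-shift^ (g̃ p r) (F^ (p ℕ.* k)) k n ⟩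
    shift^ k (g̃ p r ⊗ F^ (p ℕ.* k)) n    ≡⟨ shift^-cong k (g̃-⊗-F^ r (p ℕ.* k)) n ⟩
    shift^ k (g̃ p (p ℕ.* k ℕ.+ r)) n     ≡⟨ shift^-g̃≡d̃ r n k ⟩
    d̃ p r n k                            ∎)
    where open ≡-Reasoning

  oneₛ⊕f̃≈F^1 : oneₛ ⊕ f̃ p ≈ₛ F^ 1
  oneₛ⊕f̃≈F^1 zero    = ℚ.+-identityʳ 1ℚ
  oneₛ⊕f̃≈F^1 (suc n) = cong (0ℚ +_) (f̃≈shift-F^p (suc n))

  f̃-fixpoint : f̃ p ≈ₛ tₛ ⊗ (oneₛ ⊕ f̃ p) ^ₛ p
  f̃-fixpoint = ≈ₛ-trans f̃≈shift-F^p
    (≈ₛ-sym (≈ₛ-trans (⊗-congʳ tₛ (≈ₛ-trans (^-cong p oneₛ⊕f̃≈F^1) (F^1-^ p))) (tₛ-⊗ (F^ p))))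

  g̃-⊗-[oneₛ⊖q·f̃] : ∀ r → g̃ p r ⊗ (oneₛ ⊖ ℕ→ℚ q · f̃ p) ≈ₛ F^ (suc r)
  g̃-⊗-[oneₛ⊖q·f̃] r n = begin
    (g̃ p r ⊗ (oneₛ ⊖ c · f̃ p)) n              ≡⟨ ⊗-distribˡ-⊖ (g̃ p r) oneₛ (c · f̃ p) n ⟩
    (g̃ p r ⊗ oneₛ) n - (g̃ p r ⊗ (c · f̃ p)) n  ≡⟨ cong₂ _-_ (⊗-identityʳ (g̃ p r) n) (⊗-· c (g̃ p r) (f̃ p) n) ⟩
    g̃ p r n - c * (g̃ p r ⊗ f̃ p) n             ≡⟨ cong (λ z → g̃ p r n - c * z) (g̃⊗f̃ n) ⟩
    g̃ p r n - c * shift (g̃ p (p ℕ.+ r)) n     ≡⟨ closed-form n ⟩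
    F^-closed (suc r) n                       ≡⟨ F^≈F^-closed (suc r) n ⟨
    F^ (suc r) n                              ∎
    where
      open ≡-Reasoning
      c = ℕ→ℚ q
      g̃⊗f̃ : g̃ p r ⊗ f̃ p ≈ₛ shift (g̃ p (p ℕ.+ r))
      g̃⊗f̃ = ≈ₛ-trans (⊗-congʳ (g̃ p r) f̃≈shift-F^p) (≈ₛ-trans (⊗-shift (g̃ p r) (F^ p)) (shift-cong (g̃-⊗-F^ r p)))
      index₁ : ∀ q m r → suc q ℕ.* suc m ℕ.+ r ≡ suc (r ℕ.+ (m ℕ.+ q ℕ.* suc m))
      index₁ = solve-∀
      index₂ : ∀ q m r → suc q ℕ.* m ℕ.+ (suc q ℕ.+ r) ≡ suc (r ℕ.+ (m ℕ.+ q ℕ.* suc m))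
      index₂ = solve-∀
      closed-form : ∀ n → g̃ p r n - c * shift (g̃ p (p ℕ.+ r)) n ≡ F^-closed (suc r) n
      closed-form zero    = trans (cong (1ℚ -_) (ℚ.*-zeroʳ c)) (ℚ.+-identityʳ 1ℚ)
      closed-form (suc m) = begin
        ℕ→ℚ ((p ℕ.* suc m ℕ.+ r) C suc m) - c * ℕ→ℚ ((p ℕ.* m ℕ.+ (p ℕ.+ r)) C m)
          ≡⟨ cong₂ (λ u v → ℕ→ℚ (u C suc m) - c * ℕ→ℚ (v C m)) (index₁ q m r) (index₂ q m r) ⟩
        ℕ→ℚ (x C suc m) - c * ℕ→ℚ (x C m)
          ≡⟨ solve 3 (λ u v w → u :- w :* v := (v :+ u) :- (con 1ℚ :+ w) :* v) refl (ℕ→ℚ (x C suc m)) (ℕ→ℚ (x C m)) c ⟩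
        (ℕ→ℚ (x C m) + ℕ→ℚ (x C suc m)) - (1ℚ + c) * ℕ→ℚ (x C m)
          ≡⟨ cong₂ (λ u v → u - v * ℕ→ℚ (x C m)) (pascal x m) (ℕ→ℚ-suc q) ⟨
        ℕ→ℚ (suc x C suc m) - ℕ→ℚ p * ℕ→ℚ (x C m)
          ∎
        where x = suc (r ℕ.+ (m ℕ.+ q ℕ.* suc m))

  g̃≈[oneₛ⊕w]^⊗recip : ∀ r (w : Series) → w 0 ≡ 0ℚ → w ≈ₛ tₛ ⊗ (oneₛ ⊕ w) ^ₛ p →
                      g̃ p r ≈ₛ (oneₛ ⊕ w) ^ₛ (r ℕ.+ 1) ⊗ recipₛ (oneₛ ⊖ ℕ→ℚ q · w)
  g̃≈[oneₛ⊕w]^⊗recip r w w0≡0 w-fix = begin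
    g̃ p r                                            ≈⟨ ⊗-identityʳ (g̃ p r) ⟨
    g̃ p r ⊗ oneₛ                                     ≈⟨ ⊗-congʳ (g̃ p r) (oneₛ⊖-⊗-geomₛ∘ u (ℚ.*-zeroʳ c)) ⟨
    g̃ p r ⊗ ((oneₛ ⊖ u) ⊗ (geomₛ ∘ₛ u))              ≈⟨ ⊗-assoc (g̃ p r) (oneₛ ⊖ u) (geomₛ ∘ₛ u) ⟨
    (g̃ p r ⊗ (oneₛ ⊖ u)) ⊗ (geomₛ ∘ₛ u)              ≈⟨ ⊗-congˡ (geomₛ ∘ₛ u) (g̃-⊗-[oneₛ⊖q·f̃] r) ⟩
    F^ (suc r) ⊗ (geomₛ ∘ₛ u)                        ≈⟨ ⊗-cong powers reciprocal ⟨
    (oneₛ ⊕ w) ^ₛ (r ℕ.+ 1) ⊗ recipₛ (oneₛ ⊖ c · w)  ∎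
    where
      open ≈ₛ-Reasoning
      c = ℕ→ℚ q
      u = c · f̃ p
      w≈f̃ : w ≈ₛ f̃ p
      w≈f̃ = fixpoint-unique p w0≡0 refl w-fix f̃-fixpoint
      powers : (oneₛ ⊕ w) ^ₛ (r ℕ.+ 1) ≈ₛ F^ (suc r)
      powers = ≈ₛ-trans (^-cong (r ℕ.+ 1) (≈ₛ-trans (⊕-congˡ oneₛ w≈f̃) oneₛ⊕f̃≈F^1))
                        (≈ₛ-trans (F^1-^ (r ℕ.+ 1)) (λ n → cong (λ a → F^ a n) (ℕ.+-comm r 1)))
      reciprocal : recipₛ (oneₛ ⊖ c · w) ≈ₛ geomₛ ∘ₛ u
      reciprocal = ∘-congʳ geomₛ (λ n →
        trans (solve 3 (λ x y z → x :- (x :- z :* y) := z :* y) refl (oneₛ n) (w n) c) (cong (c *_) (w≈f̃ n)))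

  F^∘-recurrence : ∀ H → PowerRecurrence p H (λ a → F^ a ∘ₛ (tₛ ⊗ H))
  F^∘-recurrence H = record { step = λ a → begin
    F^ (suc a) ∘ₛ h                             ≈⟨ ∘-congˡ h (step F^-recurrence a) ⟩
    (F^ a ⊕ shift (oneₛ ⊗ F^ (a ℕ.+ p))) ∘ₛ h   ≈⟨ ∘-congˡ h (⊕-congˡ (F^ a) (shift-cong (⊗-identityˡ (F^ (a ℕ.+ p))))) ⟩
    (F^ a ⊕ shift (F^ (a ℕ.+ p))) ∘ₛ h          ≈⟨ ∘-distribʳ-⊕ (F^ a) (shift (F^ (a ℕ.+ p))) h ⟩
    F^ a ∘ₛ h ⊕ shift (F^ (a ℕ.+ p)) ∘ₛ h       ≈⟨ ⊕-congˡ (F^ a ∘ₛ h) (shift-∘ (F^ (a ℕ.+ p)) h (ℚ.*-zeroˡ (H 0))) ⟩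
    F^ a ∘ₛ h ⊕ h ⊗ (F^ (a ℕ.+ p) ∘ₛ h)         ≈⟨ ⊕-congˡ (F^ a ∘ₛ h) (⊗-assoc tₛ H (F^ (a ℕ.+ p) ∘ₛ h)) ⟩
    F^ a ∘ₛ h ⊕ tₛ ⊗ (H ⊗ (F^ (a ℕ.+ p) ∘ₛ h))  ≈⟨ ⊕-congˡ (F^ a ∘ₛ h) (tₛ-⊗ (H ⊗ (F^ (a ℕ.+ p) ∘ₛ h))) ⟩
    F^ a ∘ₛ h ⊕ shift (H ⊗ (F^ (a ℕ.+ p) ∘ₛ h)) ∎ }
    where
      open ≈ₛ-Reasoning
      h = tₛ ⊗ H

  geom^-recurrence : PowerRecurrence p ((oneₛ ⊖ tₛ) ^ₛ q) geom^
  geom^-recurrence = record { step = λ a → ≈ₛ-trans (geom^-suc a) (⊕-congˡ (geom^ a) (shift-cong (≈ₛ-sym (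
    ≈ₛ-trans (λ n → cong (λ b → ((oneₛ ⊖ tₛ) ^ₛ q ⊗ geom^ b) n) (ℕ.+-suc a q)) ([oneₛ⊖tₛ]^-⊗-geom^ q (suc a)))))) }

  F^∘≈geom^ : ∀ a → F^ a ∘ₛ (tₛ ⊗ (oneₛ ⊖ tₛ) ^ₛ q) ≈ₛ geom^ a
  F^∘≈geom^ = powerRecurrence-unique (F^∘-recurrence ((oneₛ ⊖ tₛ) ^ₛ q)) geom^-recurrence
    (≈ₛ-trans (∘-congˡ _ F^0≈oneₛ) (≈ₛ-trans (oneₛ-∘ _) (≈ₛ-sym geom^0≈oneₛ)))

  Fₚ∘[tₛ⊗[oneₛ⊖tₛ]^q]≈recip : Fₚ p ∘ₛ (tₛ ⊗ (oneₛ ⊖ tₛ) ^ₛ q) ≈ₛ recipₛ (oneₛ ⊖ tₛ)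
  Fₚ∘[tₛ⊗[oneₛ⊖tₛ]^q]≈recip = begin
    Fₚ p ∘ₛ h           ≈⟨ ∘-congˡ h Fₚ≈F^1 ⟩
    F^ 1 ∘ₛ h           ≈⟨ F^∘≈geom^ 1 ⟩
    geom^ 1             ≈⟨ geom^1≈geomₛ ⟩
    geomₛ               ≈⟨ geomₛ∘tₛ≈geomₛ ⟨
    geomₛ ∘ₛ tₛ         ≈⟨ ∘-congʳ geomₛ (λ n → solve 2 (λ x y → x :- (x :- y) := y) refl (oneₛ n) (tₛ n)) ⟨
    recipₛ (oneₛ ⊖ tₛ)  ∎
    where
      open ≈ₛ-Reasoning
      h = tₛ ⊗ (oneₛ ⊖ tₛ) ^ₛ q

-- The development only needs p ≥ 1; the hypothesis 2 ≤ p just rules out p = 0.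
theorem4p1 : (p r : ℕ) → 2 ≤ p →
    IsRiordanArray (d̃ p r) (g̃ p r) (f̃ p)
    × (∀ (w : Series) → w 0 ≡ 0ℚ → w ≈ₛ tₛ ⊗ (oneₛ ⊕ w) ^ₛ p →
         g̃ p r ≈ₛ (oneₛ ⊕ w) ^ₛ (r ℕ.+ 1) ⊗ recipₛ (oneₛ ⊖ ℕ→ℚ (p ∸ 1) · w))
    × f̃ p ≈ₛ Fₚ p ⊖ oneₛ
    × f̃ p ≈ₛ tₛ ⊗ Fₚ p ^ₛ p
    × Fₚ p ∘ₛ (tₛ ⊗ (oneₛ ⊖ tₛ) ^ₛ (p ∸ 1)) ≈ₛ recipₛ (oneₛ ⊖ tₛ)
theorem4p1 (suc q) r _ =
  d̃-isRiordanArray r , g̃≈[oneₛ⊕w]^⊗recip r , f̃≈Fₚ⊖oneₛ , f̃≈tₛ⊗Fₚ^p , Fₚ∘[tₛ⊗[oneₛ⊖tₛ]^q]≈recip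
  where open FussCatalan q
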